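{- Let $b$ be an integer. If $G\in\mathscr{G}(1,b)$ and $\delta(G)=1$, then $G\cong S_{b,b}$.
   Context: Graphs are finite, simple and undirected; eigenvalues are those of the adjacency matrix. An eigenvalue of $G$ is main if it has an eigenvector with nonzero entry sum. For integers $a,b$, $\mathscr{G}(a,b)$ is the set of connected graphs with exactly two main eigenvalues satisfying $\sum_{u\in N(v)}d(u)=a\,d(v)+b$ for every vertex $v$. $\delta(G)$ is the minimum degree. For $n_1,n_2\ge 1$, the double star $S_{n_1,n_2}$ is the tree on $n_1+n_2+2$ vertices obtained from an edge $uv$ by attaching $n_1$ pendant vertices to $u$ and $n_2$ pendant vertices to $v$. -}

module Defs where

open import Level using (Level; _⊔_) renaming (suc to lsuc)
open import Data.Bool using (Bool; true; false; if_then_else_; _∨_)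
open import Data.Bool.Properties using (∨-comm)
open import Data.Nat as ℕ using (ℕ; zero; suc)
open import Data.Integer as ℤ using (ℤ; +_)
open import Data.Fin using (Fin; zero; suc; toℕ)
open import Data.Product using (Σ; ∃; _×_; _,_)
open import Data.Sum using (_⊎_)
open import Relation.Nullary using (¬_)
open import Relation.Binary.PropositionalEquality using (_≡_; refl; cong₂)
open import Function.Bundles using (_↔_; Inverse)
open import Algebra.Bundles using (CommutativeRing)

record Graph (n : ℕ) : Set where
  field
    adj   : Fin n → Fin n → Bool
    sym   : ∀ u v → adj u v ≡ adj v u
    irref : ∀ v → adj v v ≡ false
open Graph public

sumℕ : ∀ {n} → (Fin n → ℕ) → ℕ
sumℕ {zero}  f = 0
sumℕ {suc n} f = f zero ℕ.+ sumℕ (λ i → f (suc i))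

deg : ∀ {n} → Graph n → Fin n → ℕ
deg G v = sumℕ (λ u → if adj G v u then 1 else 0)

degSum : ∀ {n} → Graph n → Fin n → ℕ
degSum G v = sumℕ (λ u → if adj G v u then deg G u else 0)

data Walk {n} (G : Graph n) : Fin n → Fin n → Set where
  here : ∀ {v} → Walk G v v
  step : ∀ {u v w} → adj G u v ≡ true → Walk G v w → Walk G u w

Connected : ∀ {n} → Graph n → Set
Connected {n} G = ∀ (u v : Fin n) → Walk G u v

MinDegreeOne : ∀ {n} → Graph n → Set
MinDegreeOne {n} G = (∀ v → 1 ℕ.≤ deg G v) × ∃ λ (v : Fin n) → deg G v ≡ 1

_≅_ : ∀ {n m} → Graph n → Graph m → Set
_≅_ {n} {m} G H =
  Σ (Fin n ↔ Fin m) λ f → ∀ u v → adj H (Inverse.to f u) (Inverse.to f v) ≡ adj G u v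

-- Double star S_{n1,n2}: vertex 0 = u, vertex 1 = v (u ~ v),
-- vertices 2 .. n1+1 are pendants at u, vertices n1+2 .. n1+n2+1 pendants at v.

-- directed description of the edges of S_{n1,n2} on ℕ-labels: i → j with i ∈ {0,1}
dsEdge : ℕ → ℕ → ℕ → Bool
dsEdge n1 0 1 = true
dsEdge n1 0 (suc (suc j)) = j ℕ.<ᵇ n1
dsEdge n1 1 (suc (suc j)) = n1 ℕ.≤ᵇ j
dsEdge n1 _ _ = false

dsEdge-irr : ∀ n1 k → dsEdge n1 k k ≡ false
dsEdge-irr n1 0 = refl
dsEdge-irr n1 1 = refl
dsEdge-irr n1 (suc (suc k)) = refl

doubleStar : (n1 n2 : ℕ) → Graph (n1 ℕ.+ n2 ℕ.+ 2)
doubleStar n1 n2 = record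
  { adj   = λ x y → dsEdge n1 (toℕ x) (toℕ y) ∨ dsEdge n1 (toℕ y) (toℕ x)
  ; sym   = λ x y → ∨-comm (dsEdge n1 (toℕ x) (toℕ y)) (dsEdge n1 (toℕ y) (toℕ x))
  ; irref = λ x → cong₂ _∨_ (dsEdge-irr n1 (toℕ x)) (dsEdge-irr n1 (toℕ x))
  }

-- Linear algebra over a commutative ring R (used with R a field of
-- characteristic zero, standing in for ℝ).

module _ {c ℓ : Level} (R : CommutativeRing c ℓ) where
  open CommutativeRing R using (Carrier; _≈_; _+_; _*_; 0#; 1#)

  natR : ℕ → Carrier
  natR zero    = 0#
  natR (suc n) = 1# + natR n

  record IsCharZeroField : Set (c ⊔ ℓ) where
    field
      0≉1      : ¬ (0# ≈ 1#)
      inverse  : ∀ x → ¬ (x ≈ 0#) → ∃ λ y → x * y ≈ 1#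
      charZero : ∀ k → ¬ (natR (suc k) ≈ 0#)

  sumR : ∀ {n} → (Fin n → Carrier) → Carrier
  sumR {zero}  f = 0#
  sumR {suc n} f = f zero + sumR (λ i → f (suc i))

  adjMul : ∀ {n} → Graph n → (Fin n → Carrier) → Fin n → Carrier
  adjMul G x v = sumR (λ u → if adj G v u then x u else 0#)

  IsEigenvector : ∀ {n} → Graph n → Carrier → (Fin n → Carrier) → Set ℓ
  IsEigenvector {n} G λ′ x = (¬ (∀ v → x v ≈ 0#)) × (∀ v → adjMul G x v ≈ λ′ * x v)

  IsMainEigenvalue : ∀ {n} → Graph n → Carrier → Set (c ⊔ ℓ)
  IsMainEigenvalue {n} G λ′ =
    ∃ λ (x : Fin n → Carrier) → IsEigenvector G λ′ x × ¬ (sumR x ≈ 0#)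

  ExactlyTwoMain : ∀ {n} → Graph n → Set (c ⊔ ℓ)
  ExactlyTwoMain G =
    Σ Carrier λ λ₁ → Σ Carrier λ λ₂ →
      ¬ (λ₁ ≈ λ₂) × IsMainEigenvalue G λ₁ × IsMainEigenvalue G λ₂ ×
      (∀ μ → IsMainEigenvalue G μ → (μ ≈ λ₁) ⊎ (μ ≈ λ₂))

  InClassG : ∀ {n} → Graph n → ℤ → ℤ → Set (c ⊔ ℓ)
  InClassG {n} G a b =
    Connected G × ExactlyTwoMain G ×
    (∀ (v : Fin n) → + degSum G v ≡ a ℤ.* + deg G v ℤ.+ b)

module Submission where

-- Call excess(v) = Σ_{u ∼ v} (d(u) - 1).  Without isolated vertices,
-- Σ_{u ∼ v} d(u) = d(v) + excess(v), so the equation of 𝒢(1,b) says that every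
-- vertex has excess b.  At a pendant vertex v₀ with neighbour w the excess is
-- d(w) - 1, hence b = m := d(w) - 1 ≥ 0.  If m = 0, G is K₂, whose only main
-- eigenvalue is 1, contradicting the two main eigenvalues.  If m ≥ 1, w has a
-- neighbour x of degree ≥ 2; since w alone saturates the excess of x, all other
-- neighbours of x are pendant, which forces d(x) = m + 1, and symmetrically all
-- neighbours of w but x are pendant; a connected graph of this shape is S_{m,m}.

open import Defs
open import Level using (Level)
open import Data.Nat using (ℕ; _≤_)
open import Data.Integer using (ℤ; +_)
open import Data.Product using (∃; _×_)
open import Relation.Binary.PropositionalEquality using (_≡_)
open import Algebra.Bundles using (CommutativeRing)

open import Data.Nat using (zero; suc; _+_; _∸_; _<_; z≤n; s≤s; s<s⁻¹; _<?_)
import Data.Nat.Properties as ℕP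
open import Data.Integer as ℤ using (-[1+_])
import Data.Integer.Properties as ℤP
open import Data.Bool using (Bool; true; false; if_then_else_; _∨_)
open import Data.Bool.Properties using (∨-comm)
open import Data.Fin using (Fin; zero; suc; toℕ; fromℕ<)
open import Data.Fin.Properties using (_≟_; toℕ-fromℕ<; toℕ-injective; toℕ<n)
open import Data.Product using (Σ; _,_; proj₁; proj₂)
open import Data.Sum using (_⊎_; inj₁; inj₂)
open import Data.Empty using (⊥; ⊥-elim)
open import Function using (_∘_)
open import Function.Bundles using (mk↔ₛ′)
open import Relation.Nullary using (¬_; does; yes; no)
open import Relation.Nullary.Decidable using (dec-true; dec-false)
open import Relation.Binary.PropositionalEquality using (refl; cong; cong₂; subst)
import Relation.Binary.PropositionalEquality as ≡
open import Algebra.Bundles using (CommutativeMonoid)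
import Algebra.Properties.CommutativeMonoid.Sum as MonoidSum

module PointSums {a ℓ} (M : CommutativeMonoid a ℓ) where
  open CommutativeMonoid M renaming (refl to ≈-refl; sym to ≈-sym; trans to ≈-trans)
  open MonoidSum M public using (sum; sum-cong-≗; ∑-distrib-+)
  open MonoidSum M using (sum-cong-≋; sum-replicate-zero)
  open import Relation.Binary.Reasoning.Setoid setoid
  open import Algebra.Solver.CommutativeMonoid M using (solve; _⊕_; _⊜_)

  _except_ : ∀ {n} → (Fin n → Carrier) → Fin n → Fin n → Carrier
  (f except a) i = if does (i ≟ a) then ε else f i

  sum-zero : ∀ {n} (f : Fin n → Carrier) → (∀ i → f i ≈ ε) → sum f ≈ ε
  sum-zero {n} f f≈ε = ≈-trans (sum-cong-≋ f≈ε) (sum-replicate-zero n)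

  sum-split : ∀ {n} (f : Fin n → Carrier) (a : Fin n) → sum f ≈ f a ∙ sum (f except a)
  sum-split f zero    = ∙-congˡ (≈-sym (identityˡ _))
  sum-split f (suc a) = begin
    f zero ∙ sum f′                      ≈⟨ ∙-congˡ (sum-split f′ a) ⟩
    f zero ∙ (f′ a ∙ sum (f′ except a))  ≈⟨ left-swap (f zero) (f′ a) _ ⟩
    f′ a ∙ (f zero ∙ sum (f′ except a))  ∎
    where
    f′ : _ → Carrier
    f′ i = f (suc i)
    left-swap : ∀ x y z → x ∙ (y ∙ z) ≈ y ∙ (x ∙ z)
    left-swap = solve 3 (λ x y z → x ⊕ (y ⊕ z) ⊜ y ⊕ (x ⊕ z)) ≈-refl

  sum-single : ∀ {n} (f : Fin n → Carrier) (a : Fin n) → (∀ i → ¬ i ≡ a → f i ≈ ε) → sum f ≈ f a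
  sum-single f a f≈ε = begin
    sum f                   ≈⟨ sum-split f a ⟩
    f a ∙ sum (f except a)  ≈⟨ ∙-congˡ (sum-zero _ rest) ⟩
    f a ∙ ε                 ≈⟨ identityʳ (f a) ⟩
    f a                     ∎
    where
    rest : ∀ i → (f except a) i ≈ ε
    rest i with i ≟ a
    ... | yes _  = ≈-refl
    ... | no i≢a = f≈ε i i≢a

  sum-pair : ∀ {n} (f : Fin n → Carrier) {a b : Fin n} → ¬ a ≡ b →
             (∀ i → ¬ i ≡ a → ¬ i ≡ b → f i ≈ ε) → sum f ≈ f a ∙ f b
  sum-pair f {a} {b} a≢b f≈ε = begin
    sum f                   ≈⟨ sum-split f a ⟩
    f a ∙ sum (f except a)  ≈⟨ ∙-congˡ (sum-single (f except a) b rest) ⟩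
    f a ∙ (f except a) b    ≡⟨ cong (λ t → f a ∙ (if t then ε else f b)) (dec-false (b ≟ a) (a≢b ∘ ≡.sym)) ⟩
    f a ∙ f b               ∎
    where
    rest : ∀ i → ¬ i ≡ b → (f except a) i ≈ ε
    rest i i≢b with i ≟ a
    ... | yes _  = ≈-refl
    ... | no i≢a = f≈ε i i≢a i≢b

module ℕΣ = PointSums ℕP.+-0-commutativeMonoid
open ℕΣ using (_except_)

-- The sum sumℕ of Defs unfolds exactly like the library's monoid sum, so the
-- monoid facts transfer to it.
sumℕ≡sum : ∀ {n} (f : Fin n → ℕ) → sumℕ f ≡ ℕΣ.sum f
sumℕ≡sum {zero}  f = refl
sumℕ≡sum {suc n} f = cong (λ s → f zero + s) (sumℕ≡sum (λ i → f (suc i)))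

sumℕ-cong : ∀ {n} {f g : Fin n → ℕ} → (∀ i → f i ≡ g i) → sumℕ f ≡ sumℕ g
sumℕ-cong {f = f} {g} f≗g =
  ≡.trans (sumℕ≡sum f) (≡.trans (ℕΣ.sum-cong-≗ f≗g) (≡.sym (sumℕ≡sum g)))

sumℕ-+ : ∀ {n} (f g : Fin n → ℕ) → sumℕ (λ i → f i + g i) ≡ sumℕ f + sumℕ g
sumℕ-+ f g = ≡.trans (sumℕ≡sum (λ i → f i + g i)) (≡.trans (ℕΣ.∑-distrib-+ f g)
  (≡.sym (cong₂ _+_ (sumℕ≡sum f) (sumℕ≡sum g))))

sumℕ-split : ∀ {n} (f : Fin n → ℕ) (a : Fin n) → sumℕ f ≡ f a + sumℕ (f except a)
sumℕ-split f a = ≡.trans (sumℕ≡sum f) (≡.trans (ℕΣ.sum-split f a)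
  (cong (λ s → f a + s) (≡.sym (sumℕ≡sum (f except a)))))

sumℕ-zero⁻¹ : ∀ {n} (f : Fin n → ℕ) → sumℕ f ≡ 0 → ∀ i → f i ≡ 0
sumℕ-zero⁻¹ f f₀+rest≡0 zero    = ℕP.m+n≡0⇒m≡0 (f zero) f₀+rest≡0
sumℕ-zero⁻¹ f f₀+rest≡0 (suc i) = sumℕ-zero⁻¹ (λ j → f (suc j)) (ℕP.m+n≡0⇒n≡0 (f zero) f₀+rest≡0) i

sumℕ-positive : ∀ {n} (f : Fin n → ℕ) → 0 < sumℕ f → ∃ λ i → 0 < f i
sumℕ-positive {suc n} f pos with f zero in f₀
... | suc _ = zero , subst (0 <_) (≡.sym f₀) (s≤s z≤n)
... | zero  with sumℕ-positive (λ i → f (suc i)) pos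
...   | i , fᵢ>0 = suc i , fᵢ>0

-- Counting the elements of Fin n satisfying a Boolean predicate; note that
-- deg G v is by definition count (adj G v).
count : ∀ {n} → (Fin n → Bool) → ℕ
count p = sumℕ (λ i → if p i then 1 else 0)

_without_ : ∀ {n} → (Fin n → Bool) → Fin n → Fin n → Bool
(p without c) y = if does (y ≟ c) then false else p y

without-elim : ∀ {n} (p : Fin n → Bool) {c y} → (p without c) y ≡ true → p y ≡ true × ¬ y ≡ c
without-elim p {c} {y} py with y ≟ c
... | no y≢c = py , y≢c

without-intro : ∀ {n} (p : Fin n → Bool) {c y} → p y ≡ true → ¬ y ≡ c → (p without c) y ≡ true
without-intro p {c} {y} py y≢c rewrite dec-false (y ≟ c) y≢c = py

count-without : ∀ {n} (p : Fin n → Bool) {c} → p c ≡ true → count p ≡ suc (count (p without c))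
count-without p {c} pc =
  ≡.trans (sumℕ-split (λ i → if p i then 1 else 0) c)
          (cong₂ _+_ (cong (λ t → if t then 1 else 0) pc) (sumℕ-cong pointwise))
  where
  pointwise : ∀ y → ((λ i → if p i then 1 else 0) except c) y ≡ (if (p without c) y then 1 else 0)
  pointwise y with does (y ≟ c)
  ... | true  = refl
  ... | false = refl

count-positive : ∀ {n} (p : Fin n → Bool) → 0 < count p → ∃ λ y → p y ≡ true
count-positive p pos with sumℕ-positive _ pos
... | y , χ>0 with p y in py
...   | true  = y , py
...   | false = ⊥-elim (ℕP.n≮n 0 χ>0)

-- rank p y: the number of elements before y satisfying p.  Restricted to
-- {y | p y} it is a bijection onto {0, …, count p - 1}; this enumerates the
-- leaves of a double star in the isomorphism below.
rank : ∀ {n} → (Fin n → Bool) → Fin n → ℕ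
rank p zero    = 0
rank p (suc y) = (if p zero then 1 else 0) + rank (λ i → p (suc i)) y

rank-suc : ∀ {n} {p : Fin (suc n) → Bool} {b y} → p zero ≡ b →
           rank p (suc y) ≡ (if b then 1 else 0) + rank (λ i → p (suc i)) y
rank-suc refl = refl

rank-< : ∀ {n} (p : Fin n → Bool) {y} → p y ≡ true → rank p y < count p
rank-< p {zero}  py rewrite py = s≤s z≤n
rank-< p {suc y} py with p zero
... | true  = s≤s (rank-< (λ i → p (suc i)) py)
... | false = rank-< (λ i → p (suc i)) py

rank-injective : ∀ {n} (p : Fin n → Bool) {y z} → p y ≡ true → p z ≡ true → rank p y ≡ rank p z → y ≡ z
rank-injective p {zero}  {zero}  _  _  _ = refl
rank-injective p {zero}  {suc z} py _  r = ⊥-elim (ℕP.1+n≢0 (≡.sym (≡.trans r (rank-suc {p = p} {y = z} py))))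
rank-injective p {suc y} {zero}  _  pz r = ⊥-elim (ℕP.1+n≢0 (≡.trans (≡.sym (rank-suc {p = p} {y = y} pz)) r))
rank-injective p {suc y} {suc z} py pz r with p zero
... | true  = cong suc (rank-injective (λ i → p (suc i)) py pz (ℕP.suc-injective r))
... | false = cong suc (rank-injective (λ i → p (suc i)) py pz r)

rank-surjective : ∀ {n} (p : Fin n → Bool) {r} → r < count p → ∃ λ y → p y ≡ true × rank p y ≡ r
rank-surjective {suc n} p {r} r<count with p zero in p₀
rank-surjective {suc n} p {zero}  _             | true = zero , p₀ , refl
rank-surjective {suc n} p {suc r} (s≤s r<count) | true with rank-surjective (λ i → p (suc i)) r<count
... | y , py , rank≡r = suc y , py , ≡.trans (rank-suc {p = p} {y = y} p₀) (cong suc rank≡r)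
rank-surjective {suc n} p {r} r<count | false with rank-surjective (λ i → p (suc i)) r<count
... | y , py , rank≡r = suc y , py , ≡.trans (rank-suc {p = p} {y = y} p₀) rank≡r

module _ {n} (G : Graph n) where

  adj-sym : ∀ {u v} → adj G u v ≡ true → adj G v u ≡ true
  adj-sym {u} {v} uv = ≡.trans (sym G v u) uv

  adj-≢ : ∀ {u v} → adj G u v ≡ true → ¬ u ≡ v
  adj-≢ {u} uu refl with ≡.trans (≡.sym uu) (irref G u)
  ... | ()

  neighbour : ∀ {v} → 0 < deg G v → ∃ λ u → adj G v u ≡ true
  neighbour = count-positive _

  other-neighbour : ∀ {v a} → adj G v a ≡ true → 1 < deg G v → ∃ λ z → adj G v z ≡ true × ¬ z ≡ a
  other-neighbour {v} va deg>1 with count-positive (adj G v without _)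
                                      (s<s⁻¹ (subst (1 <_) (count-without (adj G v) va) deg>1))
  ... | z , vz = z , without-elim (adj G v) vz

  pendant-unique : ∀ {v a z} → deg G v ≡ 1 → adj G v a ≡ true → adj G v z ≡ true → z ≡ a
  pendant-unique {v} {a} {z} deg≡1 va vz with z ≟ a
  ... | yes z≡a = z≡a
  ... | no  z≢a = ⊥-elim (ℕP.1+n≢0 (≡.trans (≡.sym z-counted) (sumℕ-zero⁻¹ _ no-others z)))
    where
    no-others : count (adj G v without a) ≡ 0
    no-others = ℕP.suc-injective (≡.trans (≡.sym (count-without (adj G v) va)) deg≡1)
    z-counted : (if (adj G v without a) z then 1 else 0) ≡ 1
    z-counted = cong (λ t → if t then 1 else 0) (without-intro (adj G v) vz z≢a)

  pendant-nonadj : ∀ {v a z} → deg G v ≡ 1 → adj G v a ≡ true → ¬ z ≡ a → adj G v z ≡ false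
  pendant-nonadj {v} {z = z} deg≡1 va z≢a with adj G v z in vz
  ... | true  = ⊥-elim (z≢a (pendant-unique deg≡1 va vz))
  ... | false = refl

  connected-closed : Connected G → ∀ {ℓ} (C : Fin n → Set ℓ) → (∀ {u v} → C u → adj G u v ≡ true → C v) →
                     ∀ {a} → C a → ∀ y → C y
  connected-closed conn C closed {a} Ca y = along (conn a y) Ca
    where
    along : ∀ {u y} → Walk G u y → C u → C y
    along here          Cu = Cu
    along (step uv wk) Cu = along wk (closed Cu uv)

module NeighbourSum {a ℓ} (M : CommutativeMonoid a ℓ) {n} (G : Graph n) where
  open CommutativeMonoid M using (Carrier; _≈_; ε; reflexive) renaming (refl to ≈-refl; trans to ≈-trans)
  open PointSums M using (sum; sum-single)

  nbrSum : (Fin n → Carrier) → Fin n → Carrier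
  nbrSum f v = sum (λ u → if adj G v u then f u else ε)

  pendant-nbrSum : ∀ {v a} → deg G v ≡ 1 → adj G v a ≡ true → (f : Fin n → Carrier) → nbrSum f v ≈ f a
  pendant-nbrSum {v} {a} deg≡1 va f =
    ≈-trans (sum-single _ a vanish-off-a) (reflexive (cong (λ t → if t then f a else ε) va))
    where
    vanish-off-a : ∀ z → ¬ z ≡ a → (if adj G v z then f z else ε) ≈ ε
    vanish-off-a z z≢a rewrite pendant-nonadj G deg≡1 va z≢a = ≈-refl

pendant-sumℕ : ∀ {n} (G : Graph n) {v a} → deg G v ≡ 1 → adj G v a ≡ true → (f : Fin n → ℕ) →
               sumℕ (λ u → if adj G v u then f u else 0) ≡ f a
pendant-sumℕ G {v} deg≡1 va f =
  ≡.trans (sumℕ≡sum (λ u → if adj G v u then f u else 0))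
          (NeighbourSum.pendant-nbrSum ℕP.+-0-commutativeMonoid G deg≡1 va f)

-- When G has no isolated vertex,
-- Σ_{u ∼ v} d(u) = d(v) + excess v, so for a = 1 the defining equation of
-- 𝒢(a,b) says precisely that every vertex has excess b.
excess : ∀ {n} → Graph n → Fin n → ℕ
excess G v = sumℕ (λ u → if adj G v u then deg G u ∸ 1 else 0)

module _ {n} (G : Graph n) (δ≥1 : ∀ v → 1 ≤ deg G v) where

  degSum≡deg+excess : ∀ v → degSum G v ≡ deg G v + excess G v
  degSum≡deg+excess v = ≡.trans (sumℕ-cong split-degree)
    (sumℕ-+ (λ u → if adj G v u then 1 else 0) (λ u → if adj G v u then deg G u ∸ 1 else 0))
    where
    split-degree : ∀ u → (if adj G v u then deg G u else 0) ≡
                         (if adj G v u then 1 else 0) + (if adj G v u then deg G u ∸ 1 else 0)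
    split-degree u with adj G v u
    ... | true  = ≡.sym (ℕP.m+[n∸m]≡n (δ≥1 u))
    ... | false = refl

  -- If one neighbour a of y accounts for the whole excess of y, then every
  -- other neighbour of y contributes 0, i.e. is a pendant vertex.
  saturated⇒pendant : ∀ {y a z} → adj G y a ≡ true → excess G y ≡ deg G a ∸ 1 →
                      adj G y z ≡ true → ¬ z ≡ a → deg G z ≡ 1
  saturated⇒pendant {y} {a} {z} ya saturated yz z≢a =
    ℕP.≤-antisym (ℕP.m∸n≡0⇒m≤n (≡.trans (≡.sym z-term) (sumℕ-zero⁻¹ _ rest≡0 z))) (δ≥1 z)
    where
    open ≡.≡-Reasoning
    f : Fin n → ℕ
    f u = if adj G y u then deg G u ∸ 1 else 0
    rest≡0 : sumℕ (f except a) ≡ 0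
    rest≡0 = ℕP.+-cancelˡ-≡ (deg G a ∸ 1) _ _ (begin
      deg G a ∸ 1 + sumℕ (f except a)  ≡⟨ cong (λ t → (if t then deg G a ∸ 1 else 0) + sumℕ (f except a)) ya ⟨
      f a + sumℕ (f except a)          ≡⟨ sumℕ-split f a ⟨
      excess G y                       ≡⟨ saturated ⟩
      deg G a ∸ 1                      ≡⟨ ℕP.+-identityʳ _ ⟨
      deg G a ∸ 1 + 0                  ∎)
    z-term : (f except a) z ≡ deg G z ∸ 1
    z-term rewrite dec-false (z ≟ a) z≢a | yz = refl

module _ {c ℓ} (R : CommutativeRing c ℓ) where
  open CommutativeRing R
    using (Carrier; _≈_; 0#; 1#; setoid; +-commutativeMonoid; +-cong; +-comm;
           *-congˡ; *-congʳ; *-assoc; *-identityʳ; distribˡ; reflexive)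
    renaming (_+_ to _⊕_; _*_ to _⊛_; sym to ≈-sym; trans to ≈-trans)
  open import Relation.Binary.Reasoning.Setoid setoid
  module RΣ = PointSums +-commutativeMonoid

  sumR≡sum : ∀ {n} (f : Fin n → Carrier) → sumR R f ≡ RΣ.sum f
  sumR≡sum {zero}  f = refl
  sumR≡sum {suc n} f = cong (λ s → f zero ⊕ s) (sumR≡sum (λ i → f (suc i)))

  NonzeroInvertible : Set (c Level.⊔ ℓ)
  NonzeroInvertible = ∀ x → ¬ x ≈ 0# → ∃ λ y → x ⊛ y ≈ 1#

  fixes-invertible⇒one : NonzeroInvertible → ∀ {μ s} → ¬ s ≈ 0# → μ ⊛ s ≈ s → μ ≈ 1#
  fixes-invertible⇒one inverse {μ} {s} s≉0 μs≈s with inverse s s≉0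
  ... | t , st≈1 = begin
    μ             ≈⟨ *-identityʳ μ ⟨
    μ ⊛ 1#        ≈⟨ *-congˡ st≈1 ⟨
    μ ⊛ (s ⊛ t)   ≈⟨ *-assoc μ s t ⟨
    μ ⊛ s ⊛ t     ≈⟨ *-congʳ μs≈s ⟩
    s ⊛ t         ≈⟨ st≈1 ⟩
    1#            ∎

  module _ {n} (G : Graph n) (conn : Connected G) {v₀ w : Fin n}
           (deg-v₀ : deg G v₀ ≡ 1) (deg-w : deg G w ≡ 1) (v₀w : adj G v₀ w ≡ true) where
    open NeighbourSum +-commutativeMonoid G using (pendant-nbrSum)

    K₂-vertices : ∀ y → y ≡ v₀ ⊎ y ≡ w
    K₂-vertices = connected-closed G conn (λ y → y ≡ v₀ ⊎ y ≡ w) stay (inj₁ refl)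
      where
      stay : ∀ {u v} → u ≡ v₀ ⊎ u ≡ w → adj G u v ≡ true → v ≡ v₀ ⊎ v ≡ w
      stay (inj₁ refl) uv = inj₂ (pendant-unique G deg-v₀ v₀w uv)
      stay (inj₂ refl) uv = inj₁ (pendant-unique G deg-w (adj-sym G v₀w) uv)

    sum-over-K₂ : (f : Fin n → Carrier) → sumR R f ≈ f v₀ ⊕ f w
    sum-over-K₂ f = ≈-trans (reflexive (sumR≡sum f)) (RΣ.sum-pair f (adj-≢ G v₀w) vanish)
      where
      vanish : ∀ i → ¬ i ≡ v₀ → ¬ i ≡ w → f i ≈ 0#
      vanish i i≢v₀ i≢w with K₂-vertices i
      ... | inj₁ i≡v₀ = ⊥-elim (i≢v₀ i≡v₀)
      ... | inj₂ i≡w  = ⊥-elim (i≢w i≡w)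

    -- A (x v₀, x w) = (x w, x v₀), so λ x = A x forces λ s = s for the entry sum s.
    K₂-main⇒one : NonzeroInvertible → ∀ {μ} → IsMainEigenvalue R G μ → μ ≈ 1#
    K₂-main⇒one inverse {μ} (x , (_ , Ax≈μx) , s≉0) = fixes-invertible⇒one inverse s≉0 (begin
      μ ⊛ s                            ≈⟨ *-congˡ (sum-over-K₂ x) ⟩
      μ ⊛ (x v₀ ⊕ x w)                 ≈⟨ distribˡ μ (x v₀) (x w) ⟩
      μ ⊛ x v₀ ⊕ μ ⊛ x w               ≈⟨ +-cong (Ax≈μx v₀) (Ax≈μx w) ⟨
      adjMul R G x v₀ ⊕ adjMul R G x w  ≈⟨ +-cong (A-at v₀ deg-v₀ v₀w) (A-at w deg-w (adj-sym G v₀w)) ⟩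
      x w ⊕ x v₀                       ≈⟨ +-comm (x w) (x v₀) ⟩
      x v₀ ⊕ x w                       ≈⟨ sum-over-K₂ x ⟨
      s                                ∎)
      where
      s : Carrier
      s = sumR R x
      A-at : ∀ v {a} → deg G v ≡ 1 → adj G v a ≡ true → adjMul R G x v ≈ x a
      A-at v deg≡1 va rewrite sumR≡sum (λ u → if adj G v u then x u else 0#) = pendant-nbrSum deg≡1 va x

    K₂-not-two-main : NonzeroInvertible → ¬ ExactlyTwoMain R G
    K₂-not-two-main inverse (λ₁ , λ₂ , λ₁≉λ₂ , main₁ , main₂ , _) =
      λ₁≉λ₂ (≈-trans (K₂-main⇒one inverse main₁) (≈-sym (K₂-main⇒one inverse main₂)))

-- The double star S_{n₁,n₂} on labels: the hubs are 0 and 1, the labels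
-- 2 + r (r < n₁) are the leaves at hub 0 and the labels 2 + n₁ + r the
-- leaves at hub 1.  adj (doubleStar n₁ n₂) x y is dsAdj n₁ (toℕ x) (toℕ y).
dsAdj : ℕ → ℕ → ℕ → Bool
dsAdj n₁ i j = dsEdge n₁ i j ∨ dsEdge n₁ j i

near-hub₀ : ∀ {n₁ r} → r < n₁ → dsEdge n₁ 0 (2 + r) ≡ true
near-hub₀ {n₁} {r} r<n₁ = dec-true (r <? n₁) r<n₁

far-hub₀ : ∀ n₁ r → dsEdge n₁ 0 (2 + n₁ + r) ≡ false
far-hub₀ n₁ r = dec-false (n₁ + r <? n₁) (ℕP.m+n≮m n₁ r)

near-hub₁ : ∀ {n₁ r} → r < n₁ → dsEdge n₁ 1 (2 + r) ≡ false
near-hub₁ {n₁} {r} r<n₁ = dec-false (n₁ ℕP.≤? r) (ℕP.<⇒≱ r<n₁)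

far-hub₁ : ∀ n₁ r → dsEdge n₁ 1 (2 + n₁ + r) ≡ true
far-hub₁ n₁ r = dec-true (n₁ ℕP.≤? n₁ + r) (ℕP.m≤m+n n₁ r)

-- The isomorphism sends u, v to
-- 0, 1 and enumerates the leaves at u and at v by rank.
module DoubleStarRecognition {n} (G : Graph n) (conn : Connected G) {u v : Fin n}
    (uv : adj G u v ≡ true) {n₁ n₂ : ℕ} (deg-u : deg G u ≡ suc n₁) (deg-v : deg G v ≡ suc n₂)
    (pendant₁ : ∀ {y} → adj G u y ≡ true → ¬ y ≡ v → deg G y ≡ 1)
    (pendant₂ : ∀ {y} → adj G v y ≡ true → ¬ y ≡ u → deg G y ≡ 1) where

  module Leaves (h h′ : Fin n) (hh′ : adj G h h′ ≡ true) {k : ℕ} (deg-h : deg G h ≡ suc k)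
                (pendant : ∀ {y} → adj G h y ≡ true → ¬ y ≡ h′ → deg G y ≡ 1) where
    L : Fin n → Bool
    L = adj G h without h′

    count-L : count L ≡ k
    count-L = ℕP.suc-injective (≡.trans (≡.sym (count-without (adj G h) hh′)) deg-h)

    rank-L< : ∀ {y} → L y ≡ true → rank L y < k
    rank-L< {y} p = subst (rank L y <_) count-L (rank-< L p)

    module _ {y} (p : L y ≡ true) where
      hub-adj : adj G h y ≡ true
      hub-adj = proj₁ (without-elim (adj G h) p)

      ≢partner : ¬ y ≡ h′
      ≢partner = proj₂ (without-elim (adj G h) p)

      ≢hub : ¬ y ≡ h
      ≢hub = adj-≢ G (adj-sym G hub-adj)

      only-hub : ∀ {z} → adj G y z ≡ true → z ≡ h
      only-hub = pendant-unique G (pendant hub-adj ≢partner) (adj-sym G hub-adj)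

      nonadj : ∀ {z} → ¬ z ≡ h → adj G y z ≡ false
      nonadj = pendant-nonadj G (pendant hub-adj ≢partner) (adj-sym G hub-adj)

      nonadj′ : ∀ {z} → ¬ z ≡ h → adj G z y ≡ false
      nonadj′ {z} z≢h = ≡.trans (sym G z y) (nonadj z≢h)

  module U = Leaves u v uv deg-u pendant₁
  module V = Leaves v u (adj-sym G uv) deg-v pendant₂

  u≢v : ¬ u ≡ v
  u≢v = adj-≢ G uv

  data Role (y : Fin n) : Set where
    hub₁  : y ≡ u → Role y
    hub₂  : y ≡ v → Role y
    leaf₁ : U.L y ≡ true → Role y
    leaf₂ : V.L y ≡ true → Role y

  -- every vertex has a role, since roles propagate along edges
  role : ∀ y → Role y
  role = connected-closed G conn Role propagate (hub₁ refl)
    where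
    propagate : ∀ {y z} → Role y → adj G y z ≡ true → Role z
    propagate {z = z} (hub₁ refl) yz with z ≟ v
    ... | yes z≡v = hub₂ z≡v
    ... | no  z≢v = leaf₁ (without-intro (adj G u) yz z≢v)
    propagate {z = z} (hub₂ refl) yz with z ≟ u
    ... | yes z≡u = hub₁ z≡u
    ... | no  z≢u = leaf₂ (without-intro (adj G v) yz z≢u)
    propagate (leaf₁ p) yz = hub₁ (U.only-hub p yz)
    propagate (leaf₂ q) yz = hub₂ (V.only-hub q yz)

  code : ∀ {y} → Role y → ℕ
  code     (hub₁ _)  = 0
  code     (hub₂ _)  = 1
  code {y} (leaf₁ _) = 2 + rank U.L y
  code {y} (leaf₂ _) = 2 + n₁ + rank V.L y

  -- the label does not depend on the role witness: no vertex has two roles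
  code-irrelevant : ∀ {y} (r s : Role y) → code r ≡ code s
  code-irrelevant (hub₁ _)    (hub₁ _)    = refl
  code-irrelevant (hub₁ refl) (hub₂ u≡v)  = ⊥-elim (u≢v u≡v)
  code-irrelevant (hub₁ refl) (leaf₁ q)   = ⊥-elim (U.≢hub q refl)
  code-irrelevant (hub₁ refl) (leaf₂ q)   = ⊥-elim (V.≢partner q refl)
  code-irrelevant (hub₂ refl) (hub₁ v≡u)  = ⊥-elim (u≢v (≡.sym v≡u))
  code-irrelevant (hub₂ _)    (hub₂ _)    = refl
  code-irrelevant (hub₂ refl) (leaf₁ q)   = ⊥-elim (U.≢partner q refl)
  code-irrelevant (hub₂ refl) (leaf₂ q)   = ⊥-elim (V.≢hub q refl)
  code-irrelevant (leaf₁ p)   (hub₁ refl) = ⊥-elim (U.≢hub p refl)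
  code-irrelevant (leaf₁ p)   (hub₂ refl) = ⊥-elim (U.≢partner p refl)
  code-irrelevant (leaf₁ _)   (leaf₁ _)   = refl
  code-irrelevant (leaf₁ p)   (leaf₂ q)   = ⊥-elim (u≢v (≡.sym (U.only-hub p (adj-sym G (V.hub-adj q)))))
  code-irrelevant (leaf₂ p)   (hub₁ refl) = ⊥-elim (V.≢partner p refl)
  code-irrelevant (leaf₂ p)   (hub₂ refl) = ⊥-elim (V.≢hub p refl)
  code-irrelevant (leaf₂ p)   (leaf₁ q)   = ⊥-elim (u≢v (≡.sym (U.only-hub q (adj-sym G (V.hub-adj p)))))
  code-irrelevant (leaf₂ _)   (leaf₂ _)   = refl

  leaf-codes-differ : ∀ {r s} → r < n₁ → 2 + r ≡ 2 + n₁ + s → ⊥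
  leaf-codes-differ {r} {s} r<n₁ 2+r≡2+n₁+s =
    ℕP.<⇒≱ r<n₁ (subst (n₁ ≤_) (ℕP.suc-injective (ℕP.suc-injective (≡.sym 2+r≡2+n₁+s))) (ℕP.m≤m+n n₁ s))

  code-injective : ∀ {y z} (r : Role y) (s : Role z) → code r ≡ code s → y ≡ z
  code-injective (hub₁ refl) (hub₁ refl) _ = refl
  code-injective (hub₂ refl) (hub₂ refl) _ = refl
  code-injective (leaf₁ p) (leaf₁ q) e = rank-injective U.L p q (ℕP.suc-injective (ℕP.suc-injective e))
  code-injective (leaf₂ p) (leaf₂ q) e =
    rank-injective V.L p q (ℕP.+-cancelˡ-≡ n₁ _ _ (ℕP.suc-injective (ℕP.suc-injective e)))
  code-injective (leaf₁ p) (leaf₂ q) e = ⊥-elim (leaf-codes-differ (U.rank-L< p) e)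
  code-injective (leaf₂ p) (leaf₁ q) e = ⊥-elim (leaf-codes-differ (U.rank-L< q) (≡.sym e))
  code-injective (hub₁ _) (hub₂ _)  ()
  code-injective (hub₁ _) (leaf₁ _) ()
  code-injective (hub₁ _) (leaf₂ _) ()
  code-injective (hub₂ _) (hub₁ _)  ()
  code-injective (hub₂ _) (leaf₁ _) ()
  code-injective (hub₂ _) (leaf₂ _) ()
  code-injective (leaf₁ _) (hub₁ _) ()
  code-injective (leaf₁ _) (hub₂ _) ()
  code-injective (leaf₂ _) (hub₁ _) ()
  code-injective (leaf₂ _) (hub₂ _) ()

  K : ℕ
  K = n₁ + n₂ + 2

  K≡ : K ≡ 2 + (n₁ + n₂)
  K≡ = ℕP.+-comm (n₁ + n₂) 2

  code-bound : ∀ {y} (r : Role y) → code r < K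
  code-bound r = subst (code r <_) (≡.sym K≡) (below r)
    where
    below : ∀ {y} (r : Role y) → code r < 2 + (n₁ + n₂)
    below (hub₁ _)  = s≤s z≤n
    below (hub₂ _)  = s≤s (s≤s z≤n)
    below (leaf₁ p) = s≤s (s≤s (ℕP.<-≤-trans (U.rank-L< p) (ℕP.m≤m+n n₁ n₂)))
    below (leaf₂ q) = s≤s (s≤s (ℕP.+-monoʳ-< n₁ (V.rank-L< q)))

  code-surjective : ∀ t → t < K → ∃ λ y → Σ (Role y) λ r → code r ≡ t
  code-surjective 0             _   = u , hub₁ refl , refl
  code-surjective 1             _   = v , hub₂ refl , refl
  code-surjective (suc (suc t)) t<K with t <? n₁
  ... | yes t<n₁ with rank-surjective U.L (subst (t <_) (≡.sym U.count-L) t<n₁)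
  ...   | y , p , rank≡t = y , leaf₁ p , cong (λ s → 2 + s) rank≡t
  code-surjective (suc (suc t)) t<K | no t≮n₁
    with rank-surjective V.L (subst (t ∸ n₁ <_) (≡.sym V.count-L) t∸n₁<n₂)
    where
    t∸n₁<n₂ : t ∸ n₁ < n₂
    t∸n₁<n₂ = subst (t ∸ n₁ <_) (ℕP.m+n∸m≡n n₁ n₂)
                (ℕP.∸-monoˡ-< (s<s⁻¹ (s<s⁻¹ (subst (2 + t <_) K≡ t<K))) (ℕP.≮⇒≥ t≮n₁))
  ... | y , q , rank≡t∸n₁ =
    y , leaf₂ q , cong (λ s → 2 + s) (≡.trans (cong (λ s → n₁ + s) rank≡t∸n₁) (ℕP.m+[n∸m]≡n (ℕP.≮⇒≥ t≮n₁)))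

  hub₁-adj : ∀ {z} (s : Role z) → dsAdj n₁ 0 (code s) ≡ adj G u z
  hub₁-adj (hub₁ refl) = ≡.sym (irref G u)
  hub₁-adj (hub₂ refl) = ≡.sym uv
  hub₁-adj (leaf₁ p)   = ≡.trans (cong (_∨ false) (near-hub₀ (U.rank-L< p))) (≡.sym (U.hub-adj p))
  hub₁-adj (leaf₂ q)   = ≡.trans (cong (_∨ false) (far-hub₀ n₁ _)) (≡.sym (V.nonadj′ q u≢v))

  hub₂-adj : ∀ {z} (s : Role z) → dsAdj n₁ 1 (code s) ≡ adj G v z
  hub₂-adj (hub₁ refl) = ≡.sym (adj-sym G uv)
  hub₂-adj (hub₂ refl) = ≡.sym (irref G v)
  hub₂-adj (leaf₁ p)   = ≡.trans (cong (_∨ false) (near-hub₁ (U.rank-L< p))) (≡.sym (U.nonadj′ p (u≢v ∘ ≡.sym)))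
  hub₂-adj (leaf₂ q)   = ≡.trans (cong (_∨ false) (far-hub₁ n₁ _)) (≡.sym (V.hub-adj q))

  swap : ∀ {y h} i (r : Role y) → dsAdj n₁ i (code r) ≡ adj G h y → dsAdj n₁ (code r) i ≡ adj G y h
  swap {y} {h} i r e = ≡.trans (∨-comm (dsEdge n₁ (code r) i) _) (≡.trans e (sym G h y))

  code-adj : ∀ {y z} (r : Role y) (s : Role z) → dsAdj n₁ (code r) (code s) ≡ adj G y z
  code-adj (hub₁ refl) s           = hub₁-adj s
  code-adj (hub₂ refl) s           = hub₂-adj s
  code-adj r@(leaf₁ _) (hub₁ refl) = swap 0 r (hub₁-adj r)
  code-adj r@(leaf₁ _) (hub₂ refl) = swap 1 r (hub₂-adj r)
  code-adj r@(leaf₂ _) (hub₁ refl) = swap 0 r (hub₁-adj r)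
  code-adj r@(leaf₂ _) (hub₂ refl) = swap 1 r (hub₂-adj r)
  code-adj (leaf₁ p)   (leaf₁ q)   = ≡.sym (U.nonadj p (U.≢hub q))
  code-adj (leaf₁ p)   (leaf₂ q)   = ≡.sym (U.nonadj p (V.≢partner q))
  code-adj (leaf₂ p)   (leaf₁ q)   = ≡.sym (V.nonadj p (U.≢partner q))
  code-adj (leaf₂ p)   (leaf₂ q)   = ≡.sym (V.nonadj p (V.≢hub q))

  toK : Fin n → Fin K
  toK y = fromℕ< (code-bound (role y))

  toℕ-toK : ∀ y → toℕ (toK y) ≡ code (role y)
  toℕ-toK y = toℕ-fromℕ< (code-bound (role y))

  fromK : Fin K → Fin n
  fromK t = proj₁ (code-surjective (toℕ t) (toℕ<n t))

  toK-fromK : ∀ t → toK (fromK t) ≡ t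
  toK-fromK t with code-surjective (toℕ t) (toℕ<n t)
  ... | y , r , code≡t = toℕ-injective (≡.trans (toℕ-toK y) (≡.trans (code-irrelevant (role y) r) code≡t))

  fromK-toK : ∀ y → fromK (toK y) ≡ y
  fromK-toK y with code-surjective (toℕ (toK y)) (toℕ<n (toK y))
  ... | z , s , code≡ = code-injective s (role y) (≡.trans code≡ (toℕ-toK y))

  isomorphism : G ≅ doubleStar n₁ n₂
  isomorphism = mk↔ₛ′ toK fromK toK-fromK fromK-toK , preserves
    where
    preserves : ∀ a b → adj (doubleStar n₁ n₂) (toK a) (toK b) ≡ adj G a b
    preserves a b = ≡.trans (cong₂ (dsAdj n₁) (toℕ-toK a) (toℕ-toK b)) (code-adj (role a) (role b))

doubleStar-recognition : ∀ {n} (G : Graph n) → Connected G → ∀ {u v} → adj G u v ≡ true →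
  ∀ {n₁ n₂} → deg G u ≡ suc n₁ → deg G v ≡ suc n₂ →
  (∀ {y} → adj G u y ≡ true → ¬ y ≡ v → deg G y ≡ 1) →
  (∀ {y} → adj G v y ≡ true → ¬ y ≡ u → deg G y ≡ 1) → G ≅ doubleStar n₁ n₂
doubleStar-recognition G conn uv deg-u deg-v pendant₁ pendant₂ =
  DoubleStarRecognition.isomorphism G conn uv deg-u deg-v pendant₁ pendant₂

excess-witness : ∀ {n} (G : Graph n) {v} → 0 < excess G v → ∃ λ x → adj G v x ≡ true × 1 < deg G x
excess-witness G {v} pos with sumℕ-positive _ pos
... | x , term>0 with adj G v x in vx
...   | true  = x , vx , ℕP.m∸n≢0⇒n<m (ℕP.n>0⇒n≢0 term>0)
...   | false = ⊥-elim (ℕP.n≮n 0 term>0)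

-- A connected graph without isolated vertices in which every vertex has
-- excess m ≥ 1 and some vertex w has degree m + 1 is the double star S_{m,m}:
-- w has a neighbour x of degree ≥ 2; w alone saturates the excess of x, so x
-- carries pendant vertices, whose excess d(x) - 1 = m shows d(x) = m + 1;
-- then x saturates the excess of w as well, and the recognition lemma applies.
constant-excess⇒doubleStar : ∀ {n} (G : Graph n) → Connected G → (∀ v → 1 ≤ deg G v) →
  ∀ {m w} → 1 ≤ m → (∀ v → excess G v ≡ m) → deg G w ≡ suc m → G ≅ doubleStar m m
constant-excess⇒doubleStar {n} G conn δ≥1 {m} {w} 1≤m excess≡m deg-w =
  doubleStar-recognition G conn wx deg-w deg-x pendant-at-w pendant-at-x
  where
  degree-from-excess : ∀ {v k} → deg G v ∸ 1 ≡ k → deg G v ≡ suc k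
  degree-from-excess {v} e = ≡.trans (≡.sym (ℕP.m+[n∸m]≡n (δ≥1 v))) (cong suc e)

  x-witness : ∃ λ x → adj G w x ≡ true × 1 < deg G x
  x-witness = excess-witness G (subst (0 <_) (≡.sym (excess≡m w)) 1≤m)
  x : Fin n
  x = proj₁ x-witness
  wx : adj G w x ≡ true
  wx = proj₁ (proj₂ x-witness)

  pendant-at-x : ∀ {y} → adj G x y ≡ true → ¬ y ≡ w → deg G y ≡ 1
  pendant-at-x = saturated⇒pendant G δ≥1 (adj-sym G wx)
                   (≡.trans (excess≡m x) (≡.sym (cong (_∸ 1) deg-w)))

  z-witness : ∃ λ z → adj G x z ≡ true × ¬ z ≡ w
  z-witness = other-neighbour G (adj-sym G wx) (proj₂ (proj₂ x-witness))
  z : Fin n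
  z = proj₁ z-witness
  xz : adj G x z ≡ true
  xz = proj₁ (proj₂ z-witness)
  deg-z : deg G z ≡ 1
  deg-z = pendant-at-x xz (proj₂ (proj₂ z-witness))

  deg-x : deg G x ≡ suc m
  deg-x = degree-from-excess (≡.trans (≡.sym (pendant-sumℕ G deg-z (adj-sym G xz) _)) (excess≡m _))

  pendant-at-w : ∀ {y} → adj G w y ≡ true → ¬ y ≡ x → deg G y ≡ 1
  pendant-at-w = saturated⇒pendant G δ≥1 wx (≡.trans (excess≡m w) (≡.sym (cong (_∸ 1) deg-x)))

1+b≡1+m : ∀ m b → + suc m ≡ + 1 ℤ.+ b → b ≡ + m
1+b≡1+m m (+ k)          e  = cong +_ (ℕP.suc-injective (ℤP.+-injective (≡.sym e)))
1+b≡1+m m -[1+ 0 ]       ()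
1+b≡1+m m -[1+ suc k ]   ()

class-equation⇒excess : ∀ {n} (G : Graph n) → (∀ v → 1 ≤ deg G v) → ∀ {b} →
  (∀ v → + degSum G v ≡ + 1 ℤ.* + deg G v ℤ.+ b) →
  ∀ {v₀ w m} → deg G v₀ ≡ 1 → adj G v₀ w ≡ true → deg G w ≡ suc m →
  b ≡ + m × (∀ v → excess G v ≡ m)
class-equation⇒excess G δ≥1 {b} class-eq {v₀} {w} {m} deg-v₀ v₀w deg-w = b≡m , excess≡m
  where
  open ≡.≡-Reasoning
  b≡m : b ≡ + m
  b≡m = 1+b≡1+m m b (begin
    + suc m                         ≡⟨ cong +_ deg-w ⟨
    + deg G w                       ≡⟨ cong +_ (pendant-sumℕ G deg-v₀ v₀w (deg G)) ⟨
    + degSum G v₀                   ≡⟨ class-eq v₀ ⟩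
    + 1 ℤ.* + deg G v₀ ℤ.+ b        ≡⟨ cong (λ d → + 1 ℤ.* + d ℤ.+ b) deg-v₀ ⟩
    + 1 ℤ.+ b                       ∎)
  excess≡m : ∀ v → excess G v ≡ m
  excess≡m v = ℕP.+-cancelˡ-≡ (deg G v) _ _ (begin
    deg G v + excess G v            ≡⟨ degSum≡deg+excess G δ≥1 v ⟨
    degSum G v                      ≡⟨ ℤP.+-injective (begin
      + degSum G v                    ≡⟨ class-eq v ⟩
      + 1 ℤ.* + deg G v ℤ.+ b         ≡⟨ cong₂ ℤ._+_ (ℤP.*-identityˡ (+ deg G v)) b≡m ⟩
      + deg G v ℤ.+ + m               ∎) ⟩
    deg G v + m                     ∎)

lemma4p3 : ∀ {c ℓ : Level} (R : CommutativeRing c ℓ) → IsCharZeroField R →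
    (b : ℤ) {n : ℕ} (G : Graph n) →
    InClassG R G (+ 1) b → MinDegreeOne G →
    ∃ λ (m : ℕ) → (b ≡ + m) × (1 ≤ m) × (G ≅ doubleStar m m)
lemma4p3 R char0-field b {n} G (conn , two-main , class-eq) (δ≥1 , v₀ , deg-v₀) =
  m , b≡m , 1≤m , constant-excess⇒doubleStar G conn δ≥1 1≤m excess≡m deg-w
  where
  w-witness : ∃ λ w → adj G v₀ w ≡ true
  w-witness = neighbour G (subst (0 <_) (≡.sym deg-v₀) (s≤s z≤n))
  w : Fin n
  w = proj₁ w-witness
  v₀w : adj G v₀ w ≡ true
  v₀w = proj₂ w-witness
  m : ℕ
  m = deg G w ∸ 1
  deg-w : deg G w ≡ suc m
  deg-w = ≡.sym (ℕP.m+[n∸m]≡n (δ≥1 w))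

  b≡m : b ≡ + m
  b≡m = proj₁ (class-equation⇒excess G δ≥1 class-eq deg-v₀ v₀w deg-w)
  excess≡m : ∀ v → excess G v ≡ m
  excess≡m = proj₂ (class-equation⇒excess G δ≥1 class-eq deg-v₀ v₀w deg-w)

  -- m = 0 would make G = K₂, whose only main eigenvalue is 1
  1≤m : 1 ≤ m
  1≤m = ℕP.n≢0⇒n>0 λ m≡0 →
    K₂-not-two-main R G conn deg-v₀ (≡.trans deg-w (cong suc m≡0)) v₀w
                    (IsCharZeroField.inverse char0-field) two-main
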